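{- Let $F$ be a non-empty finite union closed family of finite sets and $F_c\subseteq F$. Let $S=\bigcup F_c$ and $K=\bigcup F\setminus\bigcup F_c$. Let $w$ be a weight function on $\bigcup F$ with $w(x)=0$ for all $x\in K$. If for every union closed extension $F'$ of $F_c$ we have $\sum_{A\in F'}\bigl(2w(A)-w(\bigcup F_c)\bigr)\ge 0$, then $F$ satisfies the Frankl condition.
   Context: A function $w:X\to\mathbb{N}$ is a weight function on $A\subseteq X$ if $w(a)>0$ for some $a\in A$; $w(A)=\sum_{a\in A}w(a)$; sums computed in the integers. A family $G$ is union closed if $A\cup B\in G$ for all $A,B\in G$; it is union closed for $G_c$ if moreover $A\cup B\in G$ for all $A\in G$, $B\in G_c$. Union closed extensions of $F_c$: families $F'\subseteq\mathcal{P}(\bigcup F_c)$ union closed for $F_c$. $F$ satisfies the Frankl condition if some $a\in\bigcup F$ satisfies $2\cdot|\{A\in F: a\in A\}|\ge|F|$. -}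

module Defs where

open import Data.Nat using (ℕ; _*_; _≤_; _>_)
open import Data.Integer as ℤ using (ℤ; +_; _-_)
open import Data.Fin using (Fin)
open import Data.Fin.Subset using (Subset; _∈_; _∉_; _∪_; _─_; ⋃)
open import Data.Fin.Subset.Properties using (_∈?_)
open import Data.List using (List; length; filter; map; allFin; foldr)
open import Data.Nat.ListAction using (sum)
open import Data.List.Membership.Propositional as L using ()
open import Data.List.Relation.Unary.Unique.Propositional using (Unique)
open import Data.Product using (∃; _×_)

record Family (n : ℕ) : Set where
  constructor family
  field
    members : List (Subset n)
    unique  : Unique members
open Family public

_∈F_ : {n : ℕ} → Subset n → Family n → Set
A ∈F F = A L.∈ members F

_⊆F_ : {n : ℕ} → Family n → Family n → Set
F ⊆F G = ∀ {A} → A ∈F F → A ∈F G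

⋃F : {n : ℕ} → Family n → Subset n
⋃F F = ⋃ (members F)

∣_∣F : {n : ℕ} → Family n → ℕ
∣ F ∣F = length (members F)

NonEmptyFamily : {n : ℕ} → Family n → Set
NonEmptyFamily F = ∃ λ A → A ∈F F

_⊆S_ : {n : ℕ} → Subset n → Subset n → Set
A ⊆S B = ∀ {x} → x ∈ A → x ∈ B

UnionClosed : {n : ℕ} → Family n → Set
UnionClosed G = ∀ {A B} → A ∈F G → B ∈F G → (A ∪ B) ∈F G

UnionClosedFor : {n : ℕ} → Family n → Family n → Set
UnionClosedFor G Gc = UnionClosed G × (∀ {A B} → A ∈F G → B ∈F Gc → (A ∪ B) ∈F G)

UnionClosedExtension : {n : ℕ} → Family n → Family n → Set
UnionClosedExtension Fc F' = (∀ {A} → A ∈F F' → A ⊆S ⋃F Fc) × UnionClosedFor F' Fc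

weight : {n : ℕ} → (Fin n → ℕ) → Subset n → ℕ
weight {n} w A = sum (map w (filter (_∈? A) (allFin n)))

IsWeightFunctionOn : {n : ℕ} → (Fin n → ℕ) → Subset n → Set
IsWeightFunctionOn w A = ∃ λ a → a ∈ A × w a > 0

extensionSum : {n : ℕ} → (Fin n → ℕ) → Subset n → Family n → ℤ
extensionSum w S F' =
  foldr ℤ._+_ (+ 0) (map (λ A → (+ (2 * weight w A)) - (+ weight w S)) (members F'))

degree : {n : ℕ} → Family n → Fin n → ℕ
degree F a = length (filter (a ∈?_) (members F))

FranklCondition : {n : ℕ} → Family n → Set
FranklCondition F = ∃ λ a → a ∈ ⋃F F × ∣ F ∣F ≤ 2 * degree F a

module Submission where

open import Defs
open import Data.Nat using (ℕ)
open import Data.Integer using (+_; _≤_)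
open import Data.Fin using (Fin)
open import Data.Fin.Subset using (_∈_; _─_)
open import Relation.Binary.PropositionalEquality using (_≡_)

-- Let S = ⋃ Fc.  Every A ∈ F splits into its trace A ∩ S and its outer part
-- A ─ S.  Group the members of F into layers of equal outer part D.  On a layer
-- the map A ↦ A ∩ S is injective (A = (A ∩ S) ∪ D), and since F is union closed
-- and every C ∈ Fc lies inside S, the traces of a layer form a union closed
-- extension of Fc.  As w vanishes on ⋃F ─ S, w(A ∩ S) = w(A), so the hypothesis
-- applied to every layer and summed over all layers gives
--     |F| · w(S)  ≤  Σ_{A ∈ F} 2·w(A)  =  Σ_x 2·w(x)·deg(x)     (double counting).
-- If every x ∈ ⋃F lay in fewer than |F|/2 members, then 2·w(x)·deg(x) ≤ |F|·w(x)
-- for x ∈ S, strictly where w(x) > 0, and the right-hand side vanishes off S,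
-- so the sum would be < |F|·w(S): a contradiction (the averaging lemma).

import Algebra.Properties.CommutativeSemigroup as CommSemigroupProperties
open import Data.Bool using (true; false; if_then_else_) renaming (_≟_ to _≟ᵇ_)
open import Data.Empty using (⊥-elim)
open import Data.Fin.Properties using (any?)
open import Data.Fin.Subset using (Subset; _∩_; _∪_; ⊥; ⋃; _∉_; _⊆_)
open import Data.Fin.Subset.Properties
  using (_∈?_; x∈p∩q⁺; x∈p∩q⁻; x∈p∪q⁺; x∈p∧x∉q⇒x∈p─q; drop-∷-⊆; ∪-idem; ∪-identityʳ; ∩-distribʳ-∪)
import Data.Integer as ℤ
open import Data.Integer.Properties using (pos-+; neg-distrib-+; 0≤i-j⇒j≤i; drop‿+≤+)
import Data.Integer.Properties as ℤₚ
open import Data.List using (List; []; _∷_; map; filter; length; allFin; foldr; deduplicate)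
open import Data.List.Membership.Propositional using () renaming (_∈_ to _∈ₗ_)
open import Data.List.Membership.Propositional.Properties
  using (∈-map⁺; ∈-filter⁻; ∈-map∘filter⁺; ∈-map∘filter⁻; ∈-deduplicate⁺; ∈-allFin)
open import Data.List.Properties using (map-∘; map-id-local; filter-none)
open import Data.List.Relation.Unary.All as All using (All)
open import Data.List.Relation.Unary.All.Properties using (all-filter)
open import Data.List.Relation.Unary.AllPairs using (_∷_)
open import Data.List.Relation.Unary.Any using (here; there)
open import Data.List.Relation.Unary.Unique.Propositional using (Unique)
import Data.List.Relation.Unary.Unique.Propositional.Properties as Uniqueₚ
open import Data.List.Relation.Unary.Unique.DecPropositional.Properties using (deduplicate-!)
import Data.Nat as ℕ
open import Data.Nat using (_+_; _*_; _<_; z≤n; _≤?_; >-nonZero)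
open import Data.Nat.ListAction using (sum)
open import Data.Nat.Properties
  using (+-mono-≤; +-mono-<-≤; +-mono-≤-<; +-identityʳ; *-distribˡ-+; *-comm; *-zeroʳ;
         *-monoʳ-≤; *-monoʳ-<; <⇒≤; ≰⇒>; <-irrefl; module ≤-Reasoning)
import Data.Nat.Properties as ℕₚ
open import Data.Product using (_,_; proj₁; proj₂)
open import Data.Sum using (inj₁; inj₂)
open import Data.Vec.Base using (_∷_) renaming ([] to ⟨⟩; here to hereᵛ)
import Data.Vec.Properties as Vecₚ
open import Function using (_∘_)
open import Relation.Binary.Definitions using (DecidableEquality)
open import Relation.Binary.PropositionalEquality
  using (refl; sym; trans; cong; cong₂; subst; module ≡-Reasoning)
open import Relation.Nullary using (Dec; does; yes; no)
open import Relation.Nullary.Decidable using (_×-dec_; dec-true; dec-false)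

-- Finite sums over lists.

σ : {X : Set} → (X → ℕ) → List X → ℕ
σ f xs = sum (map f xs)

σ-cong : ∀ {X : Set} {f g : X → ℕ} (xs : List X) →
  (∀ {x} → x ∈ₗ xs → f x ≡ g x) → σ f xs ≡ σ g xs
σ-cong []       f≡g = refl
σ-cong (x ∷ xs) f≡g = cong₂ _+_ (f≡g (here refl)) (σ-cong xs (f≡g ∘ there))

σ-vanish : ∀ {X : Set} {f : X → ℕ} (xs : List X) →
  (∀ {x} → x ∈ₗ xs → f x ≡ 0) → σ f xs ≡ 0
σ-vanish []       f≡0 = refl
σ-vanish (x ∷ xs) f≡0 = cong₂ _+_ (f≡0 (here refl)) (σ-vanish xs (f≡0 ∘ there))

σ-const : ∀ {X : Set} (c : ℕ) (xs : List X) → σ (λ _ → c) xs ≡ length xs * c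
σ-const c []       = refl
σ-const c (x ∷ xs) = cong (_+_ (c)) (σ-const c xs)

σ-+ : ∀ {X : Set} (f g : X → ℕ) (xs : List X) →
  σ (λ x → f x + g x) xs ≡ σ f xs + σ g xs
σ-+ f g []       = refl
σ-+ f g (x ∷ xs) =
  trans (cong (_+_ (f x + g x)) (σ-+ f g xs)) (interchange (f x) (g x) (σ f xs) (σ g xs))
  where open CommSemigroupProperties ℕₚ.+-commutativeSemigroup using (interchange)

σ-scale : ∀ {X : Set} (c : ℕ) (f : X → ℕ) (xs : List X) →
  σ (λ x → c * f x) xs ≡ c * σ f xs
σ-scale c f []       = sym (*-zeroʳ c)
σ-scale c f (x ∷ xs) =
  trans (cong (_+_ (c * f x)) (σ-scale c f xs)) (sym (*-distribˡ-+ c (f x) (σ f xs)))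

σ-map : ∀ {X Y : Set} (f : Y → ℕ) (g : X → Y) (xs : List X) → σ f (map g xs) ≡ σ (f ∘ g) xs
σ-map f g xs = cong sum (sym (map-∘ xs))

σ-swap : ∀ {X Y : Set} (f : X → Y → ℕ) (xs : List X) (ys : List Y) →
  σ (λ x → σ (f x) ys) xs ≡ σ (λ y → σ (λ x → f x y) xs) ys
σ-swap f []       ys = sym (σ-vanish ys (λ _ → refl))
σ-swap f (x ∷ xs) ys =
  trans (cong (_+_ (σ (f x) ys)) (σ-swap f xs ys)) (sym (σ-+ (f x) _ ys))

σ-filter : ∀ {X : Set} {P : X → Set} (P? : ∀ x → Dec (P x)) (f : X → ℕ) (xs : List X) →
  σ f (filter P? xs) ≡ σ (λ x → if does (P? x) then f x else 0) xs
σ-filter P? f []       = refl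
σ-filter P? f (x ∷ xs) with does (P? x)
... | true  = cong (_+_ (f x)) (σ-filter P? f xs)
... | false = σ-filter P? f xs

σ-mono : ∀ {X : Set} {f g : X → ℕ} (xs : List X) →
  (∀ x → f x ℕ.≤ g x) → σ f xs ℕ.≤ σ g xs
σ-mono []       f≤g = z≤n
σ-mono (x ∷ xs) f≤g = +-mono-≤ (f≤g x) (σ-mono xs f≤g)

σ-mono-strict : ∀ {X : Set} {f g : X → ℕ} {a : X} (xs : List X) →
  (∀ x → f x ℕ.≤ g x) → a ∈ₗ xs → f a < g a → σ f xs < σ g xs
σ-mono-strict (x ∷ xs) f≤g (here refl) fa<ga = +-mono-<-≤ fa<ga (σ-mono xs f≤g)
σ-mono-strict (x ∷ xs) f≤g (there a∈) fa<ga = +-mono-≤-< (f≤g x) (σ-mono-strict xs f≤g a∈ fa<ga)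

-- Splitting a sum along the values of a key.  The list of keys that occur is
-- deduplicated, so every term is counted exactly once.
module Keyed {X K : Set} (_≟_ : DecidableEquality K) (key : X → K) where

  class : K → List X → List X
  class D = filter (λ x → key x ≟ D)

  σ-single : ∀ {d} (c : ℕ) {Ds : List K} → Unique Ds → d ∈ₗ Ds →
    σ (λ D → if does (d ≟ D) then c else 0) Ds ≡ c
  σ-single {d} c {_ ∷ Ds} (d∉Ds ∷ _) (here refl) rewrite dec-true (d ≟ d) refl =
    trans (cong (_+_ (c)) (σ-vanish Ds off)) (+-identityʳ c)
    where
    off : ∀ {D} → D ∈ₗ Ds → (if does (d ≟ D) then c else 0) ≡ 0
    off {D} D∈Ds rewrite dec-false (d ≟ D) (All.lookup d∉Ds D∈Ds) = refl
  σ-single {d} c {D ∷ _} (D∉Ds ∷ unique) (there d∈Ds)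
    rewrite dec-false (d ≟ D) (λ d≡D → All.lookup D∉Ds d∈Ds (sym d≡D)) =
    σ-single c unique d∈Ds

  σ-by-class : (f : X → ℕ) (xs : List X) →
    σ (λ D → σ f (class D xs)) (deduplicate _≟_ (map key xs)) ≡ σ f xs
  σ-by-class f xs = begin
    σ (λ D → σ f (class D xs)) keys
      ≡⟨ σ-cong keys (λ _ → σ-filter _ f xs) ⟩
    σ (λ D → σ (λ x → if does (key x ≟ D) then f x else 0) xs) keys
      ≡⟨ σ-swap _ keys xs ⟩
    σ (λ x → σ (λ D → if does (key x ≟ D) then f x else 0) keys) xs
      ≡⟨ σ-cong xs (λ x∈xs → σ-single _ (deduplicate-! _≟_ _) (∈-deduplicate⁺ _≟_ (∈-map⁺ key x∈xs))) ⟩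
    σ f xs ∎
    where
    open ≡-Reasoning
    keys = deduplicate _≟_ (map key xs)

  σ-mono-by-class : (f g : X → ℕ) (xs : List X) →
    (∀ D → σ f (class D xs) ℕ.≤ σ g (class D xs)) → σ f xs ℕ.≤ σ g xs
  σ-mono-by-class f g xs classwise = begin
    σ f xs                              ≡⟨ σ-by-class f xs ⟨
    σ (λ D → σ f (class D xs)) keys ≤⟨ σ-mono keys classwise ⟩
    σ (λ D → σ g (class D xs)) keys ≡⟨ σ-by-class g xs ⟩
    σ g xs                              ∎
    where
    open ≤-Reasoning
    keys = deduplicate _≟_ (map key xs)

σ-difference : ∀ {X : Set} (f g : X → ℕ) (xs : List X) →
  foldr ℤ._+_ (+ 0) (map (λ x → + f x ℤ.- + g x) xs) ≡ + σ f xs ℤ.- + σ g xs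
σ-difference f g []       = refl
σ-difference f g (x ∷ xs) = begin
  (+ f x ℤ.- + g x) ℤ.+ foldr ℤ._+_ (+ 0) (map (λ x → + f x ℤ.- + g x) xs)
    ≡⟨ cong (ℤ._+_ (+ f x ℤ.- + g x)) (σ-difference f g xs) ⟩
  (+ f x ℤ.- + g x) ℤ.+ (+ σ f xs ℤ.- + σ g xs)
    ≡⟨ interchange (+ f x) (ℤ.- + g x) (+ σ f xs) (ℤ.- + σ g xs) ⟩
  (+ f x ℤ.+ + σ f xs) ℤ.+ (ℤ.- + g x ℤ.+ ℤ.- + σ g xs)
    ≡⟨ cong₂ (λ a b → a ℤ.+ b) (sym (pos-+ (f x) (σ f xs)))
             (trans (sym (neg-distrib-+ (+ g x) (+ σ g xs))) (cong ℤ.-_ (sym (pos-+ (g x) (σ g xs))))) ⟩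
  + (f x + σ f xs) ℤ.- + (g x + σ g xs) ∎
  where
  open ≡-Reasoning
  open CommSemigroupProperties ℤₚ.+-commutativeSemigroup using (interchange)

-- Set algebra of traces A ∩ S and outer parts A ─ S.

infix 4 _≟ˢ_
_≟ˢ_ : ∀ {n} → DecidableEquality (Subset n)
_≟ˢ_ = Vecₚ.≡-dec _≟ᵇ_

∈-⋃⁺ : ∀ {n} {A : Subset n} (As : List (Subset n)) → A ∈ₗ As → A ⊆ ⋃ As
∈-⋃⁺ (B ∷ As) (here refl)  x∈A = x∈p∪q⁺ (inj₁ x∈A)
∈-⋃⁺ (B ∷ As) (there A∈As) x∈A = x∈p∪q⁺ (inj₂ (∈-⋃⁺ As A∈As x∈A))

trace∪outer : ∀ {n} (A S : Subset n) → (A ∩ S) ∪ (A ─ S) ≡ A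
trace∪outer ⟨⟩            ⟨⟩            = refl
trace∪outer (true  ∷ A) (true  ∷ S) = cong (true  ∷_) (trace∪outer A S)
trace∪outer (true  ∷ A) (false ∷ S) = cong (true  ∷_) (trace∪outer A S)
trace∪outer (false ∷ A) (true  ∷ S) = cong (false ∷_) (trace∪outer A S)
trace∪outer (false ∷ A) (false ∷ S) = cong (false ∷_) (trace∪outer A S)

─-distribʳ-∪ : ∀ {n} (A B S : Subset n) → (A ∪ B) ─ S ≡ (A ─ S) ∪ (B ─ S)
─-distribʳ-∪ ⟨⟩      ⟨⟩      ⟨⟩            = refl
─-distribʳ-∪ (a ∷ A) (b ∷ B) (true  ∷ S) = cong (false ∷_) (─-distribʳ-∪ A B S)
─-distribʳ-∪ (a ∷ A) (b ∷ B) (false ∷ S) = cong (_ ∷_) (─-distribʳ-∪ A B S)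

⊆⇒─≡⊥ : ∀ {n} (C S : Subset n) → C ⊆ S → C ─ S ≡ ⊥
⊆⇒─≡⊥ ⟨⟩          ⟨⟩            C⊆S = refl
⊆⇒─≡⊥ (c ∷ C)     (true  ∷ S) C⊆S = cong (false ∷_) (⊆⇒─≡⊥ C S (drop-∷-⊆ C⊆S))
⊆⇒─≡⊥ (false ∷ C) (false ∷ S) C⊆S = cong (false ∷_) (⊆⇒─≡⊥ C S (drop-∷-⊆ C⊆S))
⊆⇒─≡⊥ (true  ∷ C) (false ∷ S) C⊆S with C⊆S hereᵛ
... | ()

⊆⇒∩≡ : ∀ {n} (C S : Subset n) → C ⊆ S → C ∩ S ≡ C
⊆⇒∩≡ ⟨⟩          ⟨⟩          C⊆S = refl
⊆⇒∩≡ (false ∷ C) (s ∷ S)     C⊆S = cong (false ∷_) (⊆⇒∩≡ C S (drop-∷-⊆ C⊆S))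
⊆⇒∩≡ (true  ∷ C) (true ∷ S)  C⊆S = cong (true ∷_) (⊆⇒∩≡ C S (drop-∷-⊆ C⊆S))
⊆⇒∩≡ (true  ∷ C) (false ∷ S) C⊆S with C⊆S hereᵛ
... | ()

-- Weights and double counting.

weightAt : ∀ {n} → (Fin n → ℕ) → Subset n → Fin n → ℕ
weightAt w A i = if does (i ∈? A) then w i else 0

weight-as-σ : ∀ {n} (w : Fin n → ℕ) (A : Subset n) → weight w A ≡ σ (weightAt w A) (allFin n)
weight-as-σ w A = σ-filter (_∈? A) w (allFin _)

weight-trace : ∀ {n} (w : Fin n → ℕ) (A S : Subset n) →
  (∀ x → x ∈ A → x ∉ S → w x ≡ 0) → weight w (A ∩ S) ≡ weight w A
weight-trace {n} w A S w-outer = begin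
  weight w (A ∩ S)                  ≡⟨ weight-as-σ w (A ∩ S) ⟩
  σ (weightAt w (A ∩ S)) (allFin n) ≡⟨ σ-cong (allFin n) (λ {i} _ → same-summand i) ⟩
  σ (weightAt w A) (allFin n)       ≡⟨ weight-as-σ w A ⟨
  weight w A                        ∎
  where
  open ≡-Reasoning
  same-summand : ∀ i → weightAt w (A ∩ S) i ≡ weightAt w A i
  same-summand i with i ∈? A ∩ S | i ∈? A
  ... | yes _       | yes _   = refl
  ... | no  _       | no  _   = refl
  ... | yes i∈A∩S   | no  i∉A = ⊥-elim (i∉A (proj₁ (x∈p∩q⁻ A S i∈A∩S)))
  ... | no  i∉A∩S   | yes i∈A = sym (w-outer i i∈A (λ i∈S → i∉A∩S (x∈p∩q⁺ (i∈A , i∈S))))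

double-counting : ∀ {n} (w : Fin n → ℕ) (F : Family n) →
  σ (weight w) (members F) ≡ σ (λ i → w i * degree F i) (allFin n)
double-counting {n} w F = begin
  σ (weight w) (members F)                                ≡⟨ σ-cong (members F) (λ {A} _ → weight-as-σ w A) ⟩
  σ (λ A → σ (weightAt w A) (allFin n)) (members F)       ≡⟨ σ-swap (weightAt w) (members F) (allFin n) ⟩
  σ (λ i → σ (λ A → weightAt w A i) (members F)) (allFin n) ≡⟨ σ-cong (allFin n) (λ {i} _ → column i) ⟩
  σ (λ i → w i * degree F i) (allFin n)                   ∎
  where
  open ≡-Reasoning
  column : ∀ i → σ (λ A → weightAt w A i) (members F) ≡ w i * degree F i
  column i = begin
    σ (λ A → weightAt w A i) (members F)     ≡⟨ σ-filter (i ∈?_) (λ _ → w i) (members F) ⟨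
    σ (λ _ → w i) (filter (i ∈?_) (members F)) ≡⟨ σ-const (w i) (filter (i ∈?_) (members F)) ⟩
    degree F i * w i                         ≡⟨ *-comm (degree F i) (w i) ⟩
    w i * degree F i                         ∎

degree-outside : ∀ {n} (F : Family n) {i : Fin n} → i ∉ ⋃F F → degree F i ≡ 0
degree-outside F {i} i∉⋃F =
  cong length (filter-none (i ∈?_) (All.tabulate (λ A∈F i∈A → i∉⋃F (∈-⋃⁺ (members F) A∈F i∈A))))

module TraceFamilies {n : ℕ} (F Fc : Family n) (F-closed : UnionClosed F) (Fc⊆F : Fc ⊆F F) where

  S : Subset n
  S = ⋃F Fc

  has-outer : (D A : Subset n) → Dec (A ─ S ≡ D)
  has-outer D A = A ─ S ≟ˢ D

  layer : Subset n → List (Subset n)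
  layer D = filter (has-outer D) (members F)

  traces : Subset n → List (Subset n)
  traces D = map (_∩ S) (layer D)

  -- on a layer A = (A ∩ S) ∪ D, so distinct members have distinct traces
  traces-unique : ∀ D → Unique (traces D)
  traces-unique D = Uniqueₚ.map⁻ (subst Unique (sym rebuild) (Uniqueₚ.filter⁺ _ (unique F)))
    where
    rebuild : map (_∪ D) (traces D) ≡ layer D
    rebuild = trans (sym (map-∘ (layer D)))
      (map-id-local (All.map (λ {A} outer≡D → trans (cong ((A ∩ S) ∪_) (sym outer≡D)) (trace∪outer A S))
                             (all-filter _ (members F))))

  traceFamily : Subset n → Family n
  traceFamily D = family (traces D) (traces-unique D)

  layer⊆F : ∀ {A D} → A ∈ₗ layer D → A ∈ₗ members F
  layer⊆F {D = D} = proj₁ ∘ ∈-filter⁻ (has-outer D)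

  trace∈ : ∀ {A D} → A ∈ₗ members F → A ─ S ≡ D → A ∩ S ∈ₗ traces D
  trace∈ {A} {D} A∈F outer≡D = ∈-map∘filter⁺ (_∩ S) (has-outer D) (A , A∈F , refl , outer≡D)

  Fc⊆S : ∀ {C} → C ∈F Fc → C ⊆ S
  Fc⊆S = ∈-⋃⁺ (members Fc)

  traceFamily-extension : ∀ D → UnionClosedExtension Fc (traceFamily D)
  traceFamily-extension D = inside-S , closed , closed-under-Fc
    where
    inside-S : ∀ {B} → B ∈F traceFamily D → B ⊆ S
    inside-S B∈ x∈B with ∈-map∘filter⁻ (_∩ S) (has-outer D) {xs = members F} B∈
    ... | A , _ , refl , _ = proj₂ (x∈p∩q⁻ A S x∈B)

    closed : UnionClosed (traceFamily D)
    closed B∈ B'∈ with ∈-map∘filter⁻ (_∩ S) (has-outer D) {xs = members F} B∈ | ∈-map∘filter⁻ (_∩ S) (has-outer D) B'∈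
    ... | A , A∈F , refl , A─S≡D | A' , A'∈F , refl , A'─S≡D =
      subst (_∈ₗ traces D) (∩-distribʳ-∪ S A A') (trace∈ (F-closed A∈F A'∈F) outer)
      where
      outer : (A ∪ A') ─ S ≡ D
      outer = begin
        (A ∪ A') ─ S        ≡⟨ ─-distribʳ-∪ A A' S ⟩
        (A ─ S) ∪ (A' ─ S)  ≡⟨ cong₂ _∪_ A─S≡D A'─S≡D ⟩
        D ∪ D               ≡⟨ ∪-idem D ⟩
        D                   ∎
        where open ≡-Reasoning

    closed-under-Fc : ∀ {B C} → B ∈F traceFamily D → C ∈F Fc → (B ∪ C) ∈F traceFamily D
    closed-under-Fc {C = C} B∈ C∈Fc with ∈-map∘filter⁻ (_∩ S) (has-outer D) {xs = members F} B∈
    ... | A , A∈F , refl , A─S≡D =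
      subst (_∈ₗ traces D) trace (trace∈ (F-closed A∈F (Fc⊆F C∈Fc)) outer)
      where
      open ≡-Reasoning
      outer : (A ∪ C) ─ S ≡ D
      outer = begin
        (A ∪ C) ─ S        ≡⟨ ─-distribʳ-∪ A C S ⟩
        (A ─ S) ∪ (C ─ S)  ≡⟨ cong₂ _∪_ A─S≡D (⊆⇒─≡⊥ C S (Fc⊆S C∈Fc)) ⟩
        D ∪ ⊥              ≡⟨ ∪-identityʳ D ⟩
        D                  ∎
      trace : (A ∪ C) ∩ S ≡ (A ∩ S) ∪ C
      trace = trans (∩-distribʳ-∪ S A C) (cong ((A ∩ S) ∪_) (⊆⇒∩≡ C S (Fc⊆S C∈Fc)))

extension-bound : ∀ {n} (w : Fin n → ℕ) (S : Subset n) (F' : Family n) →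
  + 0 ≤ extensionSum w S F' →
  σ (λ _ → weight w S) (members F') ℕ.≤ σ (λ A → 2 * weight w A) (members F')
extension-bound w S F' 0≤sum = drop‿+≤+ (0≤i-j⇒j≤i (subst (λ z → + 0 ≤ z) as-difference 0≤sum))
  where
  as-difference = σ-difference (λ A → 2 * weight w A) (λ _ → weight w S) (members F')

-- Applying the hypothesis to the trace family of every layer of F and summing
-- over the layers:  |F|·w(S) ≤ 2·Σ_{A ∈ F} w(A).
weighted-bound : ∀ {n} (F Fc : Family n) (w : Fin n → ℕ) → UnionClosed F → Fc ⊆F F →
  (∀ x → x ∈ (⋃F F ─ ⋃F Fc) → w x ≡ 0) →
  (∀ (F' : Family n) → UnionClosedExtension Fc F' → + 0 ≤ extensionSum w (⋃F Fc) F') →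
  ∣ F ∣F * weight w (⋃F Fc) ℕ.≤ 2 * σ (weight w) (members F)
weighted-bound F Fc w F-closed Fc⊆F w-outside extensions = begin
  ∣ F ∣F * weight w S                  ≡⟨ σ-const (weight w S) (members F) ⟨
  σ (λ _ → weight w S) (members F)     ≤⟨ σ-mono-by-class _ _ (members F) layer-bound ⟩
  σ (λ A → 2 * weight w A) (members F) ≡⟨ σ-scale 2 (weight w) (members F) ⟩
  2 * σ (weight w) (members F)         ∎
  where
  open TraceFamilies F Fc F-closed Fc⊆F
  open Keyed _≟ˢ_ (_─ S) using (σ-mono-by-class)
  open ≤-Reasoning

  trace-weight : ∀ {A} → A ∈ₗ members F → weight w (A ∩ S) ≡ weight w A
  trace-weight {A} A∈F = weight-trace w A S
    (λ x x∈A x∉S → w-outside x (x∈p∧x∉q⇒x∈p─q (∈-⋃⁺ (members F) A∈F x∈A) x∉S))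

  layer-bound : ∀ D → σ (λ _ → weight w S) (layer D) ℕ.≤ σ (λ A → 2 * weight w A) (layer D)
  layer-bound D = begin
    σ (λ _ → weight w S) (layer D)           ≡⟨ σ-map _ (_∩ S) (layer D) ⟨
    σ (λ _ → weight w S) (traces D)          ≤⟨ extension-bound w S (traceFamily D) hypothesis ⟩
    σ (λ B → 2 * weight w B) (traces D)      ≡⟨ σ-map _ (_∩ S) (layer D) ⟩
    σ (λ A → 2 * weight w (A ∩ S)) (layer D) ≡⟨ σ-cong (layer D) (cong (2 *_) ∘ trace-weight ∘ layer⊆F) ⟩
    σ (λ A → 2 * weight w A) (layer D)       ∎
    where
    hypothesis = extensions (traceFamily D) (traceFamily-extension D)

scale-≤ : ∀ c {d m} → 2 * d ℕ.≤ m → 2 * (c * d) ℕ.≤ m * c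
scale-≤ c {d} {m} 2d≤m = begin
  2 * (c * d) ≡⟨ x∙yz≈y∙xz 2 c d ⟩
  c * (2 * d) ≤⟨ *-monoʳ-≤ c 2d≤m ⟩
  c * m       ≡⟨ *-comm c m ⟩
  m * c       ∎
  where
  open ≤-Reasoning
  open CommSemigroupProperties ℕₚ.*-commutativeSemigroup using (x∙yz≈y∙xz)

scale-< : ∀ c .{{_ : ℕ.NonZero c}} {d m} → 2 * d < m → 2 * (c * d) < m * c
scale-< c {d} {m} 2d<m = begin-strict
  2 * (c * d) ≡⟨ x∙yz≈y∙xz 2 c d ⟩
  c * (2 * d) <⟨ *-monoʳ-< c 2d<m ⟩
  c * m       ≡⟨ *-comm c m ⟩
  m * c       ∎
  where
  open ≤-Reasoning
  open CommSemigroupProperties ℕₚ.*-commutativeSemigroup using (x∙yz≈y∙xz)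

-- Otherwise every point of ⋃F lies in fewer than |F|/2 members, and double
-- counting gives 2·Σ_{A ∈ F} w(A) = Σ_i 2·w(i)·deg(i) < |F|·w(S).
averaging : ∀ {n} (F : Family n) (S : Subset n) (w : Fin n → ℕ) →
  IsWeightFunctionOn w (⋃F F) → (∀ x → x ∈ (⋃F F ─ S) → w x ≡ 0) →
  ∣ F ∣F * weight w S ℕ.≤ 2 * σ (weight w) (members F) → FranklCondition F
averaging {n} F S w (a , a∈⋃F , wa>0) w-outside bound
  with any? (λ i → (i ∈? ⋃F F) ×-dec (∣ F ∣F ≤? 2 * degree F i))
... | yes frankl = frankl
... | no ¬frankl = ⊥-elim (<-irrefl refl (begin-strict
  2 * σ (weight w) (members F)                 ≡⟨ cong (2 *_) (double-counting w F) ⟩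
  2 * σ (λ i → w i * degree F i) (allFin n)    ≡⟨ σ-scale 2 _ (allFin n) ⟨
  σ (λ i → 2 * (w i * degree F i)) (allFin n)  <⟨ σ-mono-strict (allFin n) pointwise (∈-allFin a) at-a ⟩
  σ (λ i → ∣ F ∣F * weightAt w S i) (allFin n) ≡⟨ σ-scale ∣ F ∣F _ (allFin n) ⟩
  ∣ F ∣F * σ (weightAt w S) (allFin n)         ≡⟨ cong (∣ F ∣F *_) (weight-as-σ w S) ⟨
  ∣ F ∣F * weight w S                          ≤⟨ bound ⟩
  2 * σ (weight w) (members F)                 ∎))
  where
  open ≤-Reasoning

  rare : ∀ {i} → i ∈ ⋃F F → 2 * degree F i < ∣ F ∣F
  rare i∈⋃F = ≰⇒> (λ |F|≤2deg → ¬frankl (_ , i∈⋃F , |F|≤2deg))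

  pointwise : ∀ i → 2 * (w i * degree F i) ℕ.≤ ∣ F ∣F * weightAt w S i
  pointwise i with i ∈? ⋃F F
  ... | no i∉⋃F rewrite degree-outside F i∉⋃F | *-zeroʳ (w i) = z≤n
  ... | yes i∈⋃F with i ∈? S
  ...   | yes _   = scale-≤ (w i) (<⇒≤ (rare i∈⋃F))
  ...   | no i∉S rewrite w-outside i (x∈p∧x∉q⇒x∈p─q i∈⋃F i∉S) = z≤n

  at-a : 2 * (w a * degree F a) < ∣ F ∣F * weightAt w S a
  at-a with a ∈? S
  ... | yes _   = scale-< (w a) {{>-nonZero wa>0}} (rare a∈⋃F)
  ... | no a∉S  = ⊥-elim (<-irrefl (sym (w-outside a (x∈p∧x∉q⇒x∈p─q a∈⋃F a∉S))) wa>0)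

lemma4 : (n : ℕ) (F Fc : Family n) (w : Fin n → ℕ) →
    NonEmptyFamily F → UnionClosed F → Fc ⊆F F →
    IsWeightFunctionOn w (⋃F F) →
    (∀ x → x ∈ (⋃F F ─ ⋃F Fc) → w x ≡ 0) →
    (∀ (F' : Family n) → UnionClosedExtension Fc F' →
      + 0 ≤ extensionSum w (⋃F Fc) F') →
    FranklCondition F
lemma4 n F Fc w _ F-closed Fc⊆F positive w-outside extensions =
  averaging F (⋃F Fc) w positive w-outside
    (weighted-bound F Fc w F-closed Fc⊆F w-outside extensions)
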